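{- Let $a_1,b_1,a_2,b_2$ be complex numbers, $p_1,p_2$ non-negative integers and $k$ a non-negative integer. Then $$S_{a_1,a_1+b_1}^{a_2,a_2+b_2,p_2}(p_1,k)=S_{a_1,b_1}^{a_2,b_2,p_2}(p_1,k)+(k+1)\,S_{a_1,b_1}^{a_2,b_2,p_2}(p_1,k+1).$$
   Context: For complex numbers $a_1,b_1,a_2,b_2$, non-negative integers $p_1,p_2$ and a non-negative integer $k$, the generalized Stirling number of the second kind is $$S_{a_1,b_1}^{a_2,b_2,p_2}(p_1,k)=\frac{1}{k!}\sum_{j=0}^{k}(-1)^j\binom{k}{j}\bigl(a_1(k-j)+b_1\bigr)^{p_1}\bigl(a_2(k-j)+b_2\bigr)^{p_2},$$ with $0^0=1$. -}

module Defs where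

open import Level using (Level)
open import Data.Nat as ℕ using (ℕ; zero; suc; _∸_)
open import Data.Nat.Combinatorics using (_C_)
open import Algebra.Bundles using (CommutativeRing)

-- All definitions are over an arbitrary commutative ring R (ℂ is not available
-- in agda-stdlib).
module Over {c ℓ : Level} (R : CommutativeRing c ℓ) where
  open CommutativeRing R hiding (zero)

  fromℕ : ℕ → Carrier
  fromℕ zero    = 0#
  fromℕ (suc n) = 1# + fromℕ n

  _^_ : Carrier → ℕ → Carrier
  x ^ zero  = 1#
  x ^ suc n = x * (x ^ n)

  sign : ℕ → Carrier
  sign zero    = 1#
  sign (suc j) = - (sign j)

  sumTo : ℕ → (ℕ → Carrier) → Carrier
  sumTo zero    f = f zero
  sumTo (suc k) f = sumTo k f + f (suc k)

  -- Generalized Stirling number S_{a1,b1}^{a2,b2,p2}(p1,k), where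
  -- invFact k is the inverse of k! in R:
  -- (1/k!) Σ_{j=0}^k (-1)^j C(k,j) (a1(k-j)+b1)^p1 (a2(k-j)+b2)^p2
  S : (invFact : ℕ → Carrier) →
      (a₁ b₁ a₂ b₂ : Carrier) (p₂ p₁ k : ℕ) → Carrier
  S invFact a₁ b₁ a₂ b₂ p₂ p₁ k =
    invFact k * sumTo k (λ j →
      sign j * fromℕ (k C j)
        * ((a₁ * fromℕ (k ∸ j) + b₁) ^ p₁)
        * ((a₂ * fromℕ (k ∸ j) + b₂) ^ p₂))

-- With g m = (a₁ m + b₁)^p₁ (a₂ m + b₂)^p₂, the inner sum of S(p₁, k) is the
-- k-th forward difference (Δᵏ g)(0), and replacing bᵢ by aᵢ + bᵢ replaces g by
-- g ∘ suc. Pascal's rule gives Δᵏ (g ∘ suc) = Δᵏ g + Δᵏ⁺¹ g at 0, and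
-- (k+1) · 1/(k+1)! = 1/k! turns this into the stated recurrence.
module Submission where

open import Defs
open import Level using (Level)
open import Algebra.Bundles using (CommutativeRing)
open import Data.Nat as ℕ using (ℕ; zero; suc; _!; _∸_; _≤_; z≤n)
open import Data.Nat.Combinatorics using (_C_; k>n⇒nCk≡0; nCk+nC[k+1]≡[n+1]C[k+1])
import Data.Nat.Properties as ℕ
open import Function using (_∘_)
open import Relation.Binary.PropositionalEquality as ≡ using (_≡_)
import Algebra.Properties.Monoid.Mult as MonoidMult
import Algebra.Properties.Semiring.Mult as SemiringMult
import Algebra.Properties.AbelianGroup as AbelianGroupProperties
import Algebra.Properties.Ring as RingProperties
import Algebra.Properties.CommutativeSemigroup as CommutativeSemigroupProperties

module StirlingProperties {c ℓ : Level} (R : CommutativeRing c ℓ) where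
  open CommutativeRing R hiding (zero)
  open Over R
  open import Relation.Binary.Reasoning.Setoid setoid
  open MonoidMult +-monoid using (_×_; ×-homo-+)
  open SemiringMult semiring using (×1-homo-*)
  open AbelianGroupProperties +-abelianGroup using (⁻¹-∙-comm; xyx⁻¹≈y)
  open RingProperties ring using (-‿distribˡ-*)
  open CommutativeSemigroupProperties *-commutativeSemigroup using (x∙yz≈y∙xz; xy∙z≈y∙xz)
  open CommutativeSemigroupProperties +-commutativeSemigroup
    using () renaming (interchange to +-interchange; x∙yz≈y∙xz to x+[y+z]≈y+[x+z])

  fromℕ≡×1# : ∀ n → fromℕ n ≡ n × 1#
  fromℕ≡×1# zero    = ≡.refl
  fromℕ≡×1# (suc n) = ≡.cong (1# +_) (fromℕ≡×1# n)

  fromℕ-+ : ∀ m n → fromℕ (m ℕ.+ n) ≈ fromℕ m + fromℕ n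
  fromℕ-+ m n
    rewrite fromℕ≡×1# (m ℕ.+ n) | fromℕ≡×1# m | fromℕ≡×1# n = ×-homo-+ 1# m n

  fromℕ-* : ∀ m n → fromℕ (m ℕ.* n) ≈ fromℕ m * fromℕ n
  fromℕ-* m n
    rewrite fromℕ≡×1# (m ℕ.* n) | fromℕ≡×1# m | fromℕ≡×1# n = ×1-homo-* m n

  ^-congˡ : ∀ n {x y} → x ≈ y → x ^ n ≈ y ^ n
  ^-congˡ zero    _   = refl
  ^-congˡ (suc n) x≈y = *-cong x≈y (^-congˡ n x≈y)

  x*a≈1∧y*[b*a]≈1⇒b*y≈x : ∀ {x y a b} → x * a ≈ 1# → y * (b * a) ≈ 1# → b * y ≈ x
  x*a≈1∧y*[b*a]≈1⇒b*y≈x {x} {y} {a} {b} xa≈1 yba≈1 = begin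
    b * y             ≈⟨ *-identityʳ (b * y) ⟨
    b * y * 1#        ≈⟨ *-congˡ xa≈1 ⟨
    b * y * (x * a)   ≈⟨ x∙yz≈y∙xz (b * y) x a ⟩
    x * (b * y * a)   ≈⟨ *-congˡ (xy∙z≈y∙xz b y a) ⟩
    x * (y * (b * a)) ≈⟨ *-congˡ yba≈1 ⟩
    x * 1#            ≈⟨ *-identityʳ x ⟩
    x                 ∎

  sumTo-cong : ∀ k {f g : ℕ → Carrier} → (∀ j → j ≤ k → f j ≈ g j) → sumTo k f ≈ sumTo k g
  sumTo-cong zero    f≈g = f≈g 0 z≤n
  sumTo-cong (suc k) f≈g =
    +-cong (sumTo-cong k (λ j j≤k → f≈g j (ℕ.m≤n⇒m≤1+n j≤k))) (f≈g (suc k) ℕ.≤-refl)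

  sumTo-+ : ∀ k (f g : ℕ → Carrier) → sumTo k (λ j → f j + g j) ≈ sumTo k f + sumTo k g
  sumTo-+ zero    f g = refl
  sumTo-+ (suc k) f g = trans (+-congʳ (sumTo-+ k f g)) (+-interchange _ _ _ _)

  sumTo-neg : ∀ k (f : ℕ → Carrier) → sumTo k (λ j → - f j) ≈ - sumTo k f
  sumTo-neg zero    f = refl
  sumTo-neg (suc k) f = trans (+-congʳ (sumTo-neg k f)) (⁻¹-∙-comm _ _)

  sumTo-suc : ∀ k (f : ℕ → Carrier) → sumTo (suc k) f ≈ f 0 + sumTo k (f ∘ suc)
  sumTo-suc zero    f = refl
  sumTo-suc (suc k) f = trans (+-congʳ (sumTo-suc k f)) (+-assoc _ _ _)

  sumTo-extend : ∀ k (f : ℕ → Carrier) → f (suc k) ≈ 0# → sumTo (suc k) f ≈ sumTo k f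
  sumTo-extend k f f[1+k]≈0 = trans (+-congˡ f[1+k]≈0) (+-identityʳ _)

  -- (Δᵏ h)(0) for the forward difference (Δ h)(m) = h (suc m) - h m
  Δ : ℕ → (ℕ → Carrier) → Carrier
  Δ k h = sumTo k (λ j → sign j * fromℕ (k C j) * h (k ∸ j))

  Δ-cong : ∀ k {g h : ℕ → Carrier} → (∀ m → g m ≈ h m) → Δ k g ≈ Δ k h
  Δ-cong k g≈h = sumTo-cong k (λ j _ → *-congˡ (g≈h _))

  pascal-term : ∀ k j x →
    sign (suc j) * fromℕ (suc k C suc j) * x
      ≈ - (sign j * fromℕ (k C j) * x) + sign (suc j) * fromℕ (k C suc j) * x
  pascal-term k j x = begin
    sign (suc j) * fromℕ (suc k C suc j) * x
      ≡⟨ ≡.cong (λ n → sign (suc j) * fromℕ n * x) (nCk+nC[k+1]≡[n+1]C[k+1] k j) ⟨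
    - s * fromℕ (k C j ℕ.+ k C suc j) * x
      ≈⟨ *-congʳ (*-congˡ (fromℕ-+ (k C j) (k C suc j))) ⟩
    - s * (fromℕ (k C j) + fromℕ (k C suc j)) * x
      ≈⟨ trans (*-congʳ (distribˡ (- s) _ _)) (distribʳ x _ _) ⟩
    - s * fromℕ (k C j) * x + - s * fromℕ (k C suc j) * x
      ≈⟨ +-congʳ (sym (trans (-‿distribˡ-* (s * fromℕ (k C j)) x)
                             (*-congʳ (-‿distribˡ-* s (fromℕ (k C j)))))) ⟩
    - (s * fromℕ (k C j) * x) + - s * fromℕ (k C suc j) * x ∎
    where s = sign j

  Δ-suc : ∀ k h → Δ (suc k) h ≈ Δ k (h ∘ suc) - Δ k h
  Δ-suc k h = begin
    Δ (suc k) h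
      ≈⟨ sumTo-suc k _ ⟩
    h₀ + sumTo k (λ j → sign (suc j) * fromℕ (suc k C suc j) * h (k ∸ j))
      ≈⟨ +-congˡ (sumTo-cong k (λ j _ → pascal-term k j (h (k ∸ j)))) ⟩
    h₀ + sumTo k (λ j → - (sign j * fromℕ (k C j) * h (k ∸ j)) + tail j)
      ≈⟨ +-congˡ (trans (sumTo-+ k _ tail) (+-congʳ (sumTo-neg k _))) ⟩
    h₀ + (- Δ k h + sumTo k tail)
      ≈⟨ trans (+-congˡ (+-comm _ _)) (sym (+-assoc _ _ _)) ⟩
    h₀ + sumTo k tail - Δ k h
      ≈⟨ +-congʳ Δ-∘suc-split ⟨
    Δ k (h ∘ suc) - Δ k h
      ∎
    where
    h₀ : Carrier
    h₀ = sign 0 * fromℕ 1 * h (suc k)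

    tail : ℕ → Carrier
    tail j = sign (suc j) * fromℕ (k C suc j) * h (k ∸ j)

    shifted : ℕ → Carrier
    shifted j = sign j * fromℕ (k C j) * h (suc k ∸ j)

    shifted-last≈0 : shifted (suc k) ≈ 0#
    shifted-last≈0 = begin
      sign (suc k) * fromℕ (k C suc k) * x
        ≡⟨ ≡.cong (λ n → sign (suc k) * fromℕ n * x) (k>n⇒nCk≡0 (ℕ.n<1+n k)) ⟩
      sign (suc k) * 0# * x ≈⟨ *-congʳ (zeroʳ _) ⟩
      0# * x                ≈⟨ zeroˡ x ⟩
      0#                    ∎
      where x = h (k ∸ k)

    Δ-∘suc-split : Δ k (h ∘ suc) ≈ h₀ + sumTo k tail
    Δ-∘suc-split = begin
      Δ k (h ∘ suc)
        ≈⟨ sumTo-cong k (λ j j≤k → reflexive (≡.cong (λ n → sign j * fromℕ (k C j) * h n)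
                                                     (≡.sym (ℕ.+-∸-assoc 1 j≤k)))) ⟩
      sumTo k shifted         ≈⟨ sumTo-extend k shifted shifted-last≈0 ⟨
      sumTo (suc k) shifted   ≈⟨ sumTo-suc k shifted ⟩
      h₀ + sumTo k tail       ∎

  Δ-∘suc : ∀ k h → Δ k (h ∘ suc) ≈ Δ k h + Δ (suc k) h
  Δ-∘suc k h = begin
    Δ k (h ∘ suc)                     ≈⟨ xyx⁻¹≈y (Δ k h) (Δ k (h ∘ suc)) ⟨
    Δ k h + Δ k (h ∘ suc) - Δ k h     ≈⟨ +-assoc _ _ _ ⟩
    Δ k h + (Δ k (h ∘ suc) - Δ k h)   ≈⟨ +-congˡ (Δ-suc k h) ⟨
    Δ k h + Δ (suc k) h               ∎

  fromℕ-suc*invFact-suc : ∀ {invFact : ℕ → Carrier} → (∀ n → invFact n * fromℕ (n !) ≈ 1#) →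
                          ∀ k → fromℕ (suc k) * invFact (suc k) ≈ invFact k
  fromℕ-suc*invFact-suc inverse k =
    x*a≈1∧y*[b*a]≈1⇒b*y≈x (inverse k)
      (trans (*-congˡ (sym (fromℕ-* (suc k) (k !)))) (inverse (suc k)))

  stirlingTerm : (a₁ b₁ a₂ b₂ : Carrier) (p₁ p₂ : ℕ) → ℕ → Carrier
  stirlingTerm a₁ b₁ a₂ b₂ p₁ p₂ m = (a₁ * fromℕ m + b₁) ^ p₁ * (a₂ * fromℕ m + b₂) ^ p₂

  S≈invFact*Δ : ∀ invFact a₁ b₁ a₂ b₂ p₁ p₂ k →
                S invFact a₁ b₁ a₂ b₂ p₂ p₁ k ≈ invFact k * Δ k (stirlingTerm a₁ b₁ a₂ b₂ p₁ p₂)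
  S≈invFact*Δ invFact a₁ b₁ a₂ b₂ p₁ p₂ k = *-congˡ (sumTo-cong k (λ j _ → *-assoc _ _ _))

  affine-suc : ∀ a b m → a * fromℕ m + (a + b) ≈ a * fromℕ (suc m) + b
  affine-suc a b m = begin
    a * fromℕ m + (a + b)     ≈⟨ x+[y+z]≈y+[x+z] (a * fromℕ m) a b ⟩
    a + (a * fromℕ m + b)     ≈⟨ +-assoc a (a * fromℕ m) b ⟨
    a + a * fromℕ m + b       ≈⟨ +-congʳ (+-congʳ (*-identityʳ a)) ⟨
    a * 1# + a * fromℕ m + b  ≈⟨ +-congʳ (distribˡ a 1# (fromℕ m)) ⟨
    a * fromℕ (suc m) + b     ∎

  stirlingTerm-shift : ∀ a₁ b₁ a₂ b₂ p₁ p₂ m →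
    stirlingTerm a₁ (a₁ + b₁) a₂ (a₂ + b₂) p₁ p₂ m ≈ stirlingTerm a₁ b₁ a₂ b₂ p₁ p₂ (suc m)
  stirlingTerm-shift a₁ b₁ a₂ b₂ p₁ p₂ m =
    *-cong (^-congˡ p₁ (affine-suc a₁ b₁ m)) (^-congˡ p₂ (affine-suc a₂ b₂ m))

lemma2 : ∀ {c ℓ : Level} (R : CommutativeRing c ℓ) →
         let open CommutativeRing R
             open Over R
         in (invFact : ℕ → Carrier) →
            (∀ n → invFact n * fromℕ (n !) ≈ 1#) →
            (a₁ b₁ a₂ b₂ : Carrier) (p₁ p₂ k : ℕ) →
            S invFact a₁ (a₁ + b₁) a₂ (a₂ + b₂) p₂ p₁ k
              ≈ S invFact a₁ b₁ a₂ b₂ p₂ p₁ k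
                + fromℕ (suc k) * S invFact a₁ b₁ a₂ b₂ p₂ p₁ (suc k)
lemma2 R invFact inverse a₁ b₁ a₂ b₂ p₁ p₂ k = begin
  S invFact a₁ (a₁ + b₁) a₂ (a₂ + b₂) p₂ p₁ k
    ≈⟨ S≈invFact*Δ invFact a₁ (a₁ + b₁) a₂ (a₂ + b₂) p₁ p₂ k ⟩
  invFact k * Δ k (stirlingTerm a₁ (a₁ + b₁) a₂ (a₂ + b₂) p₁ p₂)
    ≈⟨ *-congˡ (Δ-cong k (stirlingTerm-shift a₁ b₁ a₂ b₂ p₁ p₂)) ⟩
  invFact k * Δ k (g ∘ suc)
    ≈⟨ trans (*-congˡ (Δ-∘suc k g)) (distribˡ _ _ _) ⟩
  invFact k * Δ k g + invFact k * Δ (suc k) g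
    ≈⟨ +-congˡ (*-congʳ (fromℕ-suc*invFact-suc inverse k)) ⟨
  invFact k * Δ k g + fromℕ (suc k) * invFact (suc k) * Δ (suc k) g
    ≈⟨ +-congˡ (*-assoc _ _ _) ⟩
  invFact k * Δ k g + fromℕ (suc k) * (invFact (suc k) * Δ (suc k) g)
    ≈⟨ +-cong (S≈ k) (*-congˡ (S≈ (suc k))) ⟨
  S invFact a₁ b₁ a₂ b₂ p₂ p₁ k + fromℕ (suc k) * S invFact a₁ b₁ a₂ b₂ p₂ p₁ (suc k)
    ∎
  where
  open CommutativeRing R
  open Over R
  open StirlingProperties R
  open import Relation.Binary.Reasoning.Setoid setoid

  g : ℕ → Carrier
  g = stirlingTerm a₁ b₁ a₂ b₂ p₁ p₂

  S≈ : ∀ n → S invFact a₁ b₁ a₂ b₂ p₂ p₁ n ≈ invFact n * Δ n g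
  S≈ = S≈invFact*Δ invFact a₁ b₁ a₂ b₂ p₁ p₂
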